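{- Let $m(i,j)$ and $b(j,k)$ be the integer matrices defined below. Then for all integers $j\ge1$ and $k\ge1$, $$\nu_3(b(j,k))\ge j+1+\left\lfloor\frac{9k-9}{2}\right\rfloor.$$
   Context: $\nu_3(n)$ denotes the exponent of the highest power of $3$ dividing $n$, with $\nu_3(0)=\infty$. The matrix $\{m(i,j)\}_{i,j\ge1}$ is defined by (with $m(i,j)=0$ for $i\le0$): $m(1,1)=9$, $m(2,1)=6$, $m(3,1)=1$, $m(i,1)=0$ for $i\ge4$, and for $j\ge2$, $m(i,j)=27m(i-1,j-1)+9m(i-2,j-1)+m(i-3,j-1)$. The matrix $\{b(j,k)\}_{j,k\ge1}$ is defined by $b(1,1)=9$, $b(1,k)=0$ for $k\ge2$, and $b(j+1,k)=\sum_{i\ge1}b(j,i)m(4i+1,i+k)$ for $j,k\ge1$ (a finite sum). -}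

module Defs where

open import Data.Nat using (ℕ; zero; suc; _+_; _*_; _∸_)
open import Data.List using (List; map; upTo)
open import Data.Nat.ListAction using (sum)

-- m i j for i, j ≥ 1; index 0 encodes "i ≤ 0" (value 0); since i ∸ r
-- truncates to 0 exactly when i - r ≤ 0, m (i ∸ r) matches m(i-r, ·) with
-- the convention m(i,j) = 0 for i ≤ 0.  Column j = 0 is unused (set to 0).
m : ℕ → ℕ → ℕ
m i zero = 0
m zero (suc j) = 0
m 1 1 = 9
m 2 1 = 6
m 3 1 = 1
m (suc (suc (suc (suc i)))) 1 = 0
m (suc i) (suc (suc j)) =
  27 * m i (suc j) + 9 * m (i ∸ 1) (suc j) + m (i ∸ 2) (suc j)

Σ₁ : ℕ → (ℕ → ℕ) → ℕ
Σ₁ n f = sum (map (λ i → f (suc i)) (upTo n))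

-- b j k for j, k ≥ 1 (row j = 0 unused, set to 0).
-- The sum over i ≥ 1 is finite: m(i',j') = 0 whenever i' > 3 j', so
-- m(4i+1, i+k) = 0 for i ≥ 3k; summing i = 1 .. 3k is the full sum.
b : ℕ → ℕ → ℕ
b zero k = 0
b 1 1 = 9
b 1 k = 0
b (suc (suc j)) k = Σ₁ (3 * k) (λ i → b (suc j) i * m (4 * i + 1) (i + k))

-- Column j+1 of m holds the coefficients of (9x+6x²+x³)(27x+9x²+x³)^j, and the
-- recurrence (factors 27, 9, 1 against index shifts 1, 2, 3) gives the column bound
-- ν₃(m(i,j+1)) ≥ (9j+7−3i)/2.  Write F(k) = ⌊(9k−9)/2⌋ and induct on j in
-- b(j+1,k) = Σᵢ b(j,i) m(4i+1,i+k): a term with F(i) > F(k) is covered by the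
-- induction hypothesis on b(j,i) alone; otherwise the column bound makes
-- m(4i+1,i+k) supply the missing 1 + F(k) − F(i) factors of 3.  For i = 1 the
-- column bound falls one short when k is odd, but m(5,k+1) vanishes for k > 4 and
-- the remaining four entries are checked directly.
module Submission where

open import Defs
open import Data.Nat using (ℕ; zero; suc; _+_; _*_; _∸_; _^_; _≤_; s≤s)
open import Data.Nat.Properties
open import Data.Nat.DivMod using (_/_; _%_; m≡m%n+[m/n]*n; m%n<n; m/n*n≤m)
open import Data.Nat.Divisibility
  using (_∣_; divides; _∣?_; ∣-refl; ∣-trans; _∣0; 1∣_; m∣m*n; ∣m∣n⇒∣m+n; *-pres-∣)
open import Data.Nat.Tactic.RingSolver using (solve)
open import Data.List using (List; []; _∷_; map; upTo)
open import Data.Nat.ListAction using (sum)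
open import Data.Sum using (inj₁; inj₂)
open import Relation.Binary.PropositionalEquality
open import Relation.Nullary using (contradiction)
open import Relation.Nullary.Decidable using (from-yes; from-no)

^-monoʳ-∣ : ∀ p {a c} → a ≤ c → p ^ a ∣ p ^ c
^-monoʳ-∣ p {a} {c} a≤c = subst (λ e → p ^ a ∣ p ^ e) (m+[n∸m]≡n a≤c)
  (subst (p ^ a ∣_) (sym (^-distribˡ-+-* p a (c ∸ a))) (m∣m*n _))

-- The hypothesis on y is only needed when a ≤ n, which keeps ∸ out of the statement.
^∣-* : ∀ p {x y} a n → p ^ a ∣ x → (∀ d → n ≡ a + d → p ^ d ∣ y) → p ^ n ∣ x * y
^∣-* p {x} {y} a n pᵃ∣x rest with ≤-total n a
... | inj₁ n≤a = ∣-trans (^-monoʳ-∣ p n≤a) (∣-trans pᵃ∣x (m∣m*n y))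
... | inj₂ a≤n = subst (λ e → p ^ e ∣ x * y) (m+[n∸m]≡n a≤n)
  (subst (_∣ x * y) (sym (^-distribˡ-+-* p a (n ∸ a)))
    (*-pres-∣ pᵃ∣x (rest (n ∸ a) (sym (m+[n∸m]≡n a≤n)))))

∣-sum-map : ∀ {A : Set} {d} (f : A → ℕ) (xs : List A) → (∀ x → d ∣ f x) → d ∣ sum (map f xs)
∣-sum-map f []       d∣f = _ ∣0
∣-sum-map f (x ∷ xs) d∣f = ∣m∣n⇒∣m+n (d∣f x) (∣-sum-map f xs d∣f)

2*[n/2]≤n : ∀ n → 2 * (n / 2) ≤ n
2*[n/2]≤n n = subst (_≤ n) (*-comm (n / 2) 2) (m/n*n≤m n 2)

n≤2*[n/2]+1 : ∀ n → n ≤ 2 * (n / 2) + 1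
n≤2*[n/2]+1 n = begin
  n                    ≡⟨ m≡m%n+[m/n]*n n 2 ⟩
  n % 2 + n / 2 * 2    ≤⟨ +-monoˡ-≤ (n / 2 * 2) (≤-pred (m%n<n n 2)) ⟩
  1 + n / 2 * 2        ≡⟨ +-comm 1 (n / 2 * 2) ⟩
  n / 2 * 2 + 1        ≡⟨ cong (_+ 1) (*-comm (n / 2) 2) ⟩
  2 * (n / 2) + 1      ∎
  where open ≤-Reasoning

-- The defining recurrence; it only fires after i is split past the first-column clauses.
m-suc-suc : ∀ i j → m (suc i) (suc (suc j)) ≡ 27 * m i (suc j) + 9 * m (i ∸ 1) (suc j) + m (i ∸ 2) (suc j)
m-suc-suc zero                         j = refl
m-suc-suc (suc zero)                   j = refl
m-suc-suc (suc (suc zero))             j = refl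
m-suc-suc (suc (suc (suc zero)))       j = refl
m-suc-suc (suc (suc (suc (suc i))))    j = refl

i≤j⇒m[i,1+j]≡0 : ∀ {i j} → i ≤ j → m i (suc j) ≡ 0
i≤j⇒m[i,1+j]≡0 {zero}  {j}     i≤j       = refl
i≤j⇒m[i,1+j]≡0 {suc i} {suc j} (s≤s i≤j)
  rewrite m-suc-suc i j
        | i≤j⇒m[i,1+j]≡0 i≤j
        | i≤j⇒m[i,1+j]≡0 (≤-trans (m∸n≤m i 1) i≤j)
        | i≤j⇒m[i,1+j]≡0 (≤-trans (m∸n≤m i 2) i≤j) = refl

ColumnBound : ℕ → Set
ColumnBound j = ∀ i a → 2 * a + 3 * i ≤ 9 * j + 7 → 3 ^ a ∣ m i (suc j)

column-one : ColumnBound 0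
column-one 0 a h = _ ∣0
column-one 1 a h = ^-monoʳ-∣ 3 {a} {2} (*-cancelˡ-≤ {a} {2} 2 (+-cancelʳ-≤ 3 (2 * a) 4 h))
column-one 2 a h = ∣-trans (^-monoʳ-∣ 3 {a} {1} a≤1) (divides 2 refl)
  where a≤1 = *-cancelˡ-≤ {a} {1} 2 (≤-trans (+-cancelʳ-≤ 6 (2 * a) 1 h) (n≤1+n 1))
column-one 3 a h = contradiction (≤-trans (m≤n+m 9 (2 * a)) h) (from-no (9 ≤? 7))
column-one (suc (suc (suc (suc i)))) a h = _ ∣0

weight-drop : ∀ c d {a i j} → 9 ≤ 2 * c + 3 * d →
  2 * (c + a) + 3 * (d + i) ≤ 9 * suc j + 7 → 2 * a + 3 * i ≤ 9 * j + 7
weight-drop c d {a} {i} {j} 9≤w h = +-cancelʳ-≤ 9 (2 * a + 3 * i) (9 * j + 7) (begin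
  2 * a + 3 * i + 9                        ≤⟨ +-monoʳ-≤ (2 * a + 3 * i) 9≤w ⟩
  2 * a + 3 * i + (2 * c + 3 * d)          ≡⟨ solve (a ∷ i ∷ c ∷ d ∷ []) ⟩
  2 * (c + a) + 3 * (d + i)                ≤⟨ h ⟩
  9 * suc j + 7                            ≡⟨ solve (j ∷ []) ⟩
  9 * j + 7 + 9                            ∎)
  where open ≤-Reasoning

scaled-entry-∣ : ∀ {j} → ColumnBound j → ∀ c d i a → 9 ≤ 2 * c + 3 * d →
  2 * a + 3 * (d + i) ≤ 9 * suc j + 7 → 3 ^ a ∣ 3 ^ c * m i (suc j)
scaled-entry-∣ {j} bound c d i a 9≤w h = ^∣-* 3 c a ∣-refl λ a′ a≡c+a′ →
  bound i a′ (weight-drop c d 9≤w (subst (λ t → 2 * t + 3 * (d + i) ≤ 9 * suc j + 7) a≡c+a′ h))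

column-step : ∀ {j} → ColumnBound j → ColumnBound (suc j)
column-step bound 0 a h = _ ∣0
column-step bound 1 a h = _ ∣0
column-step bound 2 a h =
  ∣m∣n⇒∣m+n (∣m∣n⇒∣m+n (scaled-entry-∣ bound 3 1 1 a ≤-refl h) (_ ∣0)) (_ ∣0)
column-step {j} bound (suc (suc (suc i))) a h =
  subst (3 ^ a ∣_) (sym (m-suc-suc (suc (suc i)) j))
    (∣m∣n⇒∣m+n (∣m∣n⇒∣m+n (scaled-entry-∣ bound 3 1 (suc (suc i)) a ≤-refl h)
                          (scaled-entry-∣ bound 2 2 (suc i) a (n≤1+n 9) h))
               (bound i a (weight-drop 0 3 {a} {i} ≤-refl h)))

column-bound : ∀ j → ColumnBound j
column-bound zero    = column-one
column-bound (suc j) = column-step (column-bound j)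

colBound : ℕ → ℕ
colBound k = (9 * k ∸ 9) / 2

colBound-suc : ∀ k → colBound (suc k) ≡ 9 * k / 2
colBound-suc k = cong (_/ 2) (trans (cong (_∸ 9) (*-suc 9 k)) (m+n∸m≡n 9 (9 * k)))

2*colBound[1+k]≤9k : ∀ k → 2 * colBound (suc k) ≤ 9 * k
2*colBound[1+k]≤9k k = subst (λ c → 2 * c ≤ 9 * k) (sym (colBound-suc k)) (2*[n/2]≤n (9 * k))

9k≤2*colBound[1+k]+1 : ∀ k → 9 * k ≤ 2 * colBound (suc k) + 1
9k≤2*colBound[1+k]+1 k = subst (λ c → 9 * k ≤ 2 * c + 1) (sym (colBound-suc k)) (n≤2*[n/2]+1 (9 * k))

diagonal-weight : ∀ i k {c c′ d} → 9 * suc i ≤ 2 * c + 1 → 2 * c′ ≤ 9 * k → c + d ≡ c′ →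
  2 * suc d + 3 * (4 * suc (suc i) + 1) ≤ 9 * (suc i + suc k) + 7
diagonal-weight i k {c} {c′} {d} lower upper c+d≡c′ = begin
  2 * suc d + 3 * (4 * suc (suc i) + 1)  ≡⟨ solve (d ∷ i ∷ []) ⟩
  2 * d + (9 * i + 8) + (3 * i + 21)     ≤⟨ +-mono-≤ 2d+9i+8≤9k (+-mono-≤ (*-monoˡ-≤ i (m≤m+n 3 6)) (m≤m+n 21 4)) ⟩
  9 * k + (9 * i + 25)                   ≡⟨ solve (i ∷ k ∷ []) ⟩
  9 * (suc i + suc k) + 7                ∎
  where
  open ≤-Reasoning
  9i+8≤2c : 9 * i + 8 ≤ 2 * c
  9i+8≤2c = +-cancelʳ-≤ 1 (9 * i + 8) (2 * c) (begin
    9 * i + 8 + 1  ≡⟨ solve (i ∷ []) ⟩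
    9 * suc i      ≤⟨ lower ⟩
    2 * c + 1      ∎)
  2d+9i+8≤9k : 2 * d + (9 * i + 8) ≤ 9 * k
  2d+9i+8≤9k = begin
    2 * d + (9 * i + 8)  ≤⟨ +-monoʳ-≤ (2 * d) 9i+8≤2c ⟩
    2 * d + 2 * c        ≡⟨ solve (d ∷ c ∷ []) ⟩
    2 * (c + d)          ≡⟨ cong (2 *_) c+d≡c′ ⟩
    2 * c′               ≤⟨ upper ⟩
    9 * k                ∎

m[5,2+k]-∣ : ∀ k → 3 ^ suc (colBound (suc k)) ∣ m 5 (suc (suc k))
m[5,2+k]-∣ 0 = from-yes (3 ^ 1 ∣? m 5 2)
m[5,2+k]-∣ 1 = from-yes (3 ^ 5 ∣? m 5 3)
m[5,2+k]-∣ 2 = from-yes (3 ^ 10 ∣? m 5 4)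
m[5,2+k]-∣ 3 = from-yes (3 ^ 14 ∣? m 5 5)
m[5,2+k]-∣ (suc (suc (suc (suc k)))) =
  subst (3 ^ suc (colBound (5 + k)) ∣_) (sym (i≤j⇒m[i,1+j]≡0 (m≤m+n 5 k))) (_ ∣0)

diagonal-entry-∣ : ∀ i k d → colBound (suc i) + d ≡ colBound (suc k) →
  3 ^ suc d ∣ m (4 * suc i + 1) (suc i + suc k)
diagonal-entry-∣ zero    k d refl = m[5,2+k]-∣ k
diagonal-entry-∣ (suc i) k d eq   = column-bound (suc i + suc k) (4 * suc (suc i) + 1) (suc d)
  (diagonal-weight i k (9k≤2*colBound[1+k]+1 (suc i)) (2*colBound[1+k]≤9k k) eq)

exponent-gap : ∀ x c c′ d → suc (x + c′) ≡ x + c + suc d → c + d ≡ c′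
exponent-gap x c c′ d eq = sym (+-cancelˡ-≡ x c′ (c + d) (suc-injective (begin
  suc (x + c′)       ≡⟨ eq ⟩
  x + c + suc d      ≡⟨ solve (x ∷ c ∷ d ∷ []) ⟩
  suc (x + (c + d))  ∎)))
  where open ≡-Reasoning

b-bound : ∀ j k → 3 ^ (suc j + 1 + colBound (suc k)) ∣ b (suc j) (suc k)
b-bound zero    zero    = ∣-refl
b-bound zero    (suc k) = _ ∣0
b-bound (suc j) k       = ∣-sum-map _ (upTo (3 * suc k)) term
  where
  term : ∀ i → 3 ^ (suc (suc j) + 1 + colBound (suc k)) ∣ b (suc j) (suc i) * m (4 * suc i + 1) (suc i + suc k)
  term i = ^∣-* 3 (suc j + 1 + colBound (suc i)) _ (b-bound j i) gap
    where
    gap : ∀ d → suc (suc j + 1 + colBound (suc k)) ≡ suc j + 1 + colBound (suc i) + d →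
      3 ^ d ∣ m (4 * suc i + 1) (suc i + suc k)
    gap zero    _  = 1∣ _
    gap (suc d) eq = diagonal-entry-∣ i k d (exponent-gap (suc j + 1) _ _ d eq)

lemma3p6 : (j k : ℕ) → 1 ≤ j → 1 ≤ k →
    3 ^ (j + 1 + (9 * k ∸ 9) / 2) ∣ b j k
lemma3p6 (suc j) (suc k) _ _ = b-bound j k
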